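{- Let $\ell\geq0$, let $S\subseteq\Sigma^*_\ell$ be a set of mutually compatible words, and let $e$ be a boring extension of $S$. Then there exists a boring extension $e'$ of $\Sigma^*_\ell$ such that $S^\frown e\subseteq(\Sigma^*_\ell)^\frown e'$.
   Context: Let $\Sigma=\{\mathrm L,\mathrm X,\mathrm R\}$ with $\mathrm L<_{\mathrm{lex}}\mathrm X<_{\mathrm{lex}}\mathrm R$; $\Sigma^*$ finite words with lexicographic order $\leq_{\mathrm{lex}}$; $|w|$ length; $w|_i$ initial segment of length $i$; $\Sigma^*_\ell$ words of length $\ell$. For $S\subseteq\Sigma^*$, $\overline S=\{w|_i:w\in S,0\leq i\leq|w|\}$ and $\overline S_i$ its words of length $i$. $w\prec w'$ iff there is $i<\min(|w|,|w'|)$ with $(w_i,w'_i)=(\mathrm L,\mathrm R)$ and $w_j\leq_{\mathrm{lex}}w'_j$ for all $j<i$; $w\preceq w'$ iff $w\prec w'$ or $w=w'$. For words of equal length $\ell$: $w\trianglelefteq w'$ iff $w_i\leq_{\mathrm{lex}}w'_i$ for all $i<\ell$. For $A\subseteq\Sigma^*_i$, the level structure of $A$ is $(A,\leq_{\mathrm{lex}},\preceq,\trianglelefteq)$. Words $u\leq_{\mathrm{lex}}v$ are compatible if (1) no $k<\min(|u|,|v|)$ has $(u_k,v_k)=(\mathrm R,\mathrm L)$ and (2) if some $k'<\min(|u|,|v|)$ has $(u_{k'},v_{k'})=(\mathrm L,\mathrm R)$ then $u_{k''}\leq_{\mathrm{lex}}v_{k''}$ for all $k''<\min(|u|,|v|)$;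 a set is mutually compatible if every two of its words are compatible. Interesting levels: for $S\subseteq\Sigma^*$, a level $i\geq0$ is interesting if (1) the level structures of $\overline S_i$ and $\overline S_{i+1}$ are not isomorphic, or (2) there are incompatible $u,v\in\overline S_{i+1}$ with $u|_i,v|_i$ compatible, or (3) some $u\in S$ has $|u|=i$. Boring extensions: for $A=\{u^0<_{\mathrm{lex}}\cdots<_{\mathrm{lex}}u^{n-1}\}\subseteq\Sigma^*_\ell$ and $e\in\Sigma^*_n$ put $A^\frown e=\{(u^i)^\frown e_i:0\leq i<n\}$, where $(u^i)^\frown e_i$ is $u^i$ followed by the letter $e_i$. The word $e$ is a boring extension of $A$ if level $\ell$ of the set $A^\frown e$ is not interesting. -}

module Defs where

open import Data.Nat using (ℕ; zero; suc; _≤_)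
open import Data.Product using (Σ; ∃; ∃-syntax; _×_; _,_)
open import Data.Sum using (_⊎_)
open import Data.List using (List; []; _∷_; _++_; [_]; length; take; map; concatMap; zip; zipWith)
open import Data.List.Membership.Propositional using (_∈_)
open import Data.List.Relation.Unary.Any using (Any)
open import Data.List.Relation.Unary.All using (All)
open import Data.List.Relation.Binary.Pointwise using (Pointwise)
open import Data.Vec using (Vec; toList)
open import Relation.Binary.PropositionalEquality using (_≡_)
open import Relation.Nullary using (¬_)
open import Function.Bundles using (_⇔_)

data Letter : Set where
  L X R : Letter

data _<Σ_ : Letter → Letter → Set where
  L<X : L <Σ X
  L<R : L <Σ R
  X<R : X <Σ R

_≤Σ_ : Letter → Letter → Set
a ≤Σ b = (a <Σ b) ⊎ (a ≡ b)

Word : Set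
Word = List Letter

data _≤lex_ : Word → Word → Set where
  []≤ : ∀ {v} → [] ≤lex v
  <∷ : ∀ {a b u v} → a <Σ b → (a ∷ u) ≤lex (b ∷ v)
  ≡∷ : ∀ {a u v} → u ≤lex v → (a ∷ u) ≤lex (a ∷ v)

_<lex_ : Word → Word → Set
u <lex v = (u ≤lex v) × ¬ (u ≡ v)

data _≺_ : Word → Word → Set where
  here  : ∀ {u v} → (L ∷ u) ≺ (R ∷ v)
  there : ∀ {a b u v} → a ≤Σ b → u ≺ v → (a ∷ u) ≺ (b ∷ v)

_≼_ : Word → Word → Set
w ≼ w' = (w ≺ w') ⊎ (w ≡ w')

_⊴_ : Word → Word → Set
w ⊴ w' = Pointwise _≤Σ_ w w'

-- Compatibility of u ≤lex v (the pairs (u_k, v_k) for k < min(|u|,|v|)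
-- are exactly the entries of zip u v).
CompatOrd : Word → Word → Set
CompatOrd u v =
  ¬ Any (λ p → p ≡ (R , L)) (zip u v)
  × (Any (λ p → p ≡ (L , R)) (zip u v) →
     All (λ p → Data.Product.proj₁ p ≤Σ Data.Product.proj₂ p) (zip u v))

Compatible : Word → Word → Set
Compatible u v = (u ≤lex v → CompatOrd u v) × (v ≤lex u → CompatOrd v u)

MutuallyCompatible : List Word → Set
MutuallyCompatible S = ∀ {u v} → u ∈ S → v ∈ S → Compatible u v

Bar : List Word → ℕ → Word → Set
Bar S i w = ∃[ u ] (u ∈ S × i ≤ length u × w ≡ take i u)

LevelIso : (Word → Set) → (Word → Set) → Set
LevelIso A B =
  Σ (Word → Word) λ f → Σ (Word → Word) λ g →
    (∀ u → A u → B (f u)) × (∀ v → B v → A (g v))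
    × (∀ u → A u → g (f u) ≡ u) × (∀ v → B v → f (g v) ≡ v)
    × (∀ u v → A u → A v →
         ((u ≤lex v) ⇔ (f u ≤lex f v))
         × ((u ≼ v) ⇔ (f u ≼ f v))
         × ((u ⊴ v) ⇔ (f u ⊴ f v)))

Interesting : List Word → ℕ → Set
Interesting S i =
  ¬ LevelIso (Bar S i) (Bar S (suc i))
  ⊎ (∃[ u ] ∃[ v ] (Bar S (suc i) u × Bar S (suc i) v
        × ¬ Compatible u v × Compatible (take i u) (take i v)))
  ⊎ (∃[ u ] (u ∈ S × length u ≡ i))

-- A^e, for A = [u⁰, …, u^{n-1}] listed in strictly increasing lex order
ext : (A : List Word) → Vec Letter (length A) → List Word
ext A e = zipWith (λ u a → u ++ [ a ]) A (toList e)

Boring : (ℓ : ℕ) (A : List Word) → Vec Letter (length A) → Set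
Boring ℓ A e = ¬ Interesting (ext A e) ℓ

-- Σ*_ℓ listed in increasing lexicographic order
allWords : ℕ → List Word
allWords zero = [ [] ]
allWords (suc ℓ) = concatMap (λ a → map (a ∷_) (allWords ℓ)) (L ∷ X ∷ R ∷ [])

{-# OPTIONS --safe #-}
-- Read L, X, R as 0, 1, 2. For the graph P of e, let excess u w = max_i (u_i ∸ w_i) and
-- F w = max over (u , a) ∈ P of (a ∸ excess u w), a McShane-type extension. F is monotone
-- for ⊴ and 1-Lipschitz for letterwise distance, and appending such an F to every word of
-- Σ*_ℓ preserves the three orders and compatibility, so it is a boring extension.
-- F agrees with e on S once a ∸ excess u v ≤ b for all (u , a), (v , b) ∈ P. This follows
-- from e being boring: the level isomorphism must be u ↦ u e_u since both levels are lex
-- sorted, so it transports ⊴ and ≼; and the only remaining bad case, e_u = R, e_v = L with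
-- excess u v = X, produces an incompatible pair over compatible prefixes.
module Submission where

open import Defs
open import Data.Nat using (ℕ; suc; pred; _≤_)
open import Data.Nat.Properties using (≤-reflexive; n≤1+n; 1+n≢n)
open import Data.Product using (Σ-syntax; ∃-syntax; _×_; _,_; proj₁; proj₂; swap)
open import Data.Sum using (_⊎_; inj₁; inj₂)
open import Data.Empty using (⊥; ⊥-elim)
open import Data.Unit using (⊤; tt)
open import Data.List using (List; []; _∷_; _++_; [_]; length; take; map; zip)
open import Data.List.Properties using (∷ʳ-injectiveˡ; take-all; ∷-injective)
open import Data.List.Membership.Propositional using (_∈_)
open import Data.List.Membership.Propositional.Properties using (∈-map⁺; ∈-map⁻; ∈-concatMap⁺; ∈-concatMap⁻)
open import Data.List.Relation.Unary.Any using (Any; here; there; any?; satisfied)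
open import Data.List.Relation.Unary.All using (All; []; _∷_; all?; tabulate) renaming (lookup to All-lookup)
open import Data.List.Relation.Unary.Linked using (Linked; []; [-]; _∷_) renaming (tail to Linked-tail)
open import Data.List.Relation.Unary.Linked.Properties using (Linked⇒All)
open import Data.List.Relation.Binary.Pointwise using (Pointwise; []; _∷_; ++⁺; symmetric)
open import Data.Vec using (Vec; fromList) renaming ([] to []ᵥ; _∷_ to _∷ᵥ_; map to mapᵥ)
open import Relation.Binary.PropositionalEquality
  using (_≡_; _≢_; refl; sym; trans; cong; cong₂; subst; subst₂)
open import Relation.Nullary using (¬_; Dec; yes; no)
open import Function.Bundles using (_⇔_; mk⇔; Equivalence)

≤Σ-refl : ∀ {a} → a ≤Σ a
≤Σ-refl = inj₂ refl

L≤Σ : ∀ {a} → L ≤Σ a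
L≤Σ {L} = ≤Σ-refl
L≤Σ {X} = inj₁ L<X
L≤Σ {R} = inj₁ L<R

≤ΣR : ∀ {a} → a ≤Σ R
≤ΣR {L} = inj₁ L<R
≤ΣR {X} = inj₁ X<R
≤ΣR {R} = ≤Σ-refl

≤Σ-trans : ∀ {a b c} → a ≤Σ b → b ≤Σ c → a ≤Σ c
≤Σ-trans (inj₂ refl) q = q
≤Σ-trans p (inj₂ refl) = p
≤Σ-trans (inj₁ L<X) (inj₁ X<R) = inj₁ L<R

<Σ-trans : ∀ {a b c} → a <Σ b → b <Σ c → a <Σ c
<Σ-trans L<X X<R = L<R

<Σ-irrefl : ∀ {a} → ¬ (a <Σ a)
<Σ-irrefl ()

<Σ-asym : ∀ {a b} → a <Σ b → ¬ (b <Σ a)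
<Σ-asym L<X ()
<Σ-asym L<R ()
<Σ-asym X<R ()

≤Σ-antisym : ∀ {a b} → a ≤Σ b → b ≤Σ a → a ≡ b
≤Σ-antisym (inj₂ refl) _ = refl
≤Σ-antisym _ (inj₂ refl) = refl
≤Σ-antisym (inj₁ p) (inj₁ q) = ⊥-elim (<Σ-asym p q)

<Σ⇒≱Σ : ∀ {a b} → a <Σ b → ¬ (b ≤Σ a)
<Σ⇒≱Σ p (inj₁ q) = <Σ-asym p q
<Σ⇒≱Σ p (inj₂ refl) = <Σ-irrefl p

≤ΣL⇒≡L : ∀ {a} → a ≤Σ L → a ≡ L
≤ΣL⇒≡L (inj₂ refl) = refl
≤ΣL⇒≡L (inj₁ ())

R≰ΣL : ¬ (R ≤Σ L)
R≰ΣL p with ≤ΣL⇒≡L p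
... | ()

<Σ-trichotomy : ∀ a b → a <Σ b ⊎ a ≡ b ⊎ b <Σ a
<Σ-trichotomy L L = inj₂ (inj₁ refl)
<Σ-trichotomy L X = inj₁ L<X
<Σ-trichotomy L R = inj₁ L<R
<Σ-trichotomy X L = inj₂ (inj₂ L<X)
<Σ-trichotomy X X = inj₂ (inj₁ refl)
<Σ-trichotomy X R = inj₁ X<R
<Σ-trichotomy R L = inj₂ (inj₂ L<R)
<Σ-trichotomy R X = inj₂ (inj₂ X<R)
<Σ-trichotomy R R = inj₂ (inj₁ refl)

_≤Σ?_ : ∀ a b → Dec (a ≤Σ b)
a ≤Σ? b with <Σ-trichotomy a b
... | inj₁ p = yes (inj₁ p)
... | inj₂ (inj₁ p) = yes (inj₂ p)
... | inj₂ (inj₂ p) = no (<Σ⇒≱Σ p)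

_⊔_ : Letter → Letter → Letter
L ⊔ b = b
X ⊔ L = X
X ⊔ X = X
X ⊔ R = R
R ⊔ b = R

_∸_ : Letter → Letter → Letter
L ∸ _ = L
X ∸ L = X
X ∸ _ = L
R ∸ L = R
R ∸ X = X
R ∸ R = L

a≤a⊔b : ∀ a b → a ≤Σ (a ⊔ b)
a≤a⊔b L b = L≤Σ
a≤a⊔b X L = ≤Σ-refl
a≤a⊔b X X = ≤Σ-refl
a≤a⊔b X R = inj₁ X<R
a≤a⊔b R b = ≤Σ-refl

b≤a⊔b : ∀ a b → b ≤Σ (a ⊔ b)
b≤a⊔b L b = ≤Σ-refl
b≤a⊔b X L = inj₁ L<X
b≤a⊔b X X = ≤Σ-refl
b≤a⊔b X R = ≤Σ-refl
b≤a⊔b R b = ≤ΣR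

⊔-lub : ∀ {a b c} → a ≤Σ c → b ≤Σ c → (a ⊔ b) ≤Σ c
⊔-lub {L} p q = q
⊔-lub {X} {L} p q = p
⊔-lub {X} {X} p q = p
⊔-lub {X} {R} p q = q
⊔-lub {R} p q = p

⊔-mono : ∀ {a b c d} → a ≤Σ c → b ≤Σ d → (a ⊔ b) ≤Σ (c ⊔ d)
⊔-mono {c = c} {d} p q = ⊔-lub (≤Σ-trans p (a≤a⊔b c d)) (≤Σ-trans q (b≤a⊔b c d))

⊔-zeroʳ : ∀ a → a ⊔ R ≡ R
⊔-zeroʳ L = refl
⊔-zeroʳ X = refl
⊔-zeroʳ R = refl

⊔≡L⇒ : ∀ {a b} → a ⊔ b ≡ L → a ≡ L × b ≡ L
⊔≡L⇒ {L} p = refl , p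
⊔≡L⇒ {X} {L} ()
⊔≡L⇒ {X} {X} ()
⊔≡L⇒ {X} {R} ()

⊔≡R⇒ : ∀ {a b} → a ⊔ b ≡ R → a ≡ R ⊎ b ≡ R
⊔≡R⇒ {L} p = inj₂ p
⊔≡R⇒ {X} {R} p = inj₂ refl
⊔≡R⇒ {R} p = inj₁ refl

∸-antitoneʳ : ∀ a {b c} → b ≤Σ c → (a ∸ c) ≤Σ (a ∸ b)
∸-antitoneʳ a (inj₂ refl) = ≤Σ-refl
∸-antitoneʳ L (inj₁ _) = ≤Σ-refl
∸-antitoneʳ X (inj₁ L<X) = inj₁ L<X
∸-antitoneʳ X (inj₁ L<R) = inj₁ L<X
∸-antitoneʳ X (inj₁ X<R) = ≤Σ-refl
∸-antitoneʳ R (inj₁ L<X) = inj₁ X<R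
∸-antitoneʳ R (inj₁ L<R) = inj₁ L<R
∸-antitoneʳ R (inj₁ X<R) = inj₁ L<X

∸-identityʳ : ∀ a → a ∸ L ≡ a
∸-identityʳ L = refl
∸-identityʳ X = refl
∸-identityʳ R = refl

a∸a≡L : ∀ a → a ∸ a ≡ L
a∸a≡L L = refl
a∸a≡L X = refl
a∸a≡L R = refl

a∸R≡L : ∀ a → a ∸ R ≡ L
a∸R≡L L = refl
a∸R≡L X = refl
a∸R≡L R = refl

∸≡L⇒≤Σ : ∀ {a b} → a ∸ b ≡ L → a ≤Σ b
∸≡L⇒≤Σ {L} _ = L≤Σ
∸≡L⇒≤Σ {X} {X} _ = ≤Σ-refl
∸≡L⇒≤Σ {X} {R} _ = inj₁ X<R
∸≡L⇒≤Σ {R} {R} _ = ≤Σ-refl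

≤Σ⇒∸≡L : ∀ {a b} → a ≤Σ b → a ∸ b ≡ L
≤Σ⇒∸≡L {a} (inj₂ refl) = a∸a≡L a
≤Σ⇒∸≡L {b = R} (inj₁ _) = a∸R≡L _
≤Σ⇒∸≡L (inj₁ L<X) = refl

∸≡R⇒ : ∀ {a b} → a ∸ b ≡ R → a ≡ R × b ≡ L
∸≡R⇒ {R} {L} _ = refl , refl
∸≡R⇒ {X} {L} ()
∸≡R⇒ {X} {X} ()
∸≡R⇒ {X} {R} ()
∸≡R⇒ {R} {X} ()
∸≡R⇒ {R} {R} ()

R∸≡L⇒ : ∀ {b} → R ∸ b ≡ L → b ≡ R
R∸≡L⇒ {R} _ = refl

Near : Letter → Letter → Set
Near L R = ⊥
Near R L = ⊥
Near _ _ = ⊤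

Near-sym : ∀ {a b} → Near a b → Near b a
Near-sym {L} {L} n = tt
Near-sym {L} {X} n = tt
Near-sym {X} {L} n = tt
Near-sym {X} {X} n = tt
Near-sym {X} {R} n = tt
Near-sym {R} {X} n = tt
Near-sym {R} {R} n = tt

near-or-LR-or-RL : ∀ a b → Near a b ⊎ (a , b) ≡ (L , R) ⊎ (a , b) ≡ (R , L)
near-or-LR-or-RL L L = inj₁ tt
near-or-LR-or-RL L X = inj₁ tt
near-or-LR-or-RL L R = inj₂ (inj₁ refl)
near-or-LR-or-RL X L = inj₁ tt
near-or-LR-or-RL X X = inj₁ tt
near-or-LR-or-RL X R = inj₁ tt
near-or-LR-or-RL R L = inj₂ (inj₂ refl)
near-or-LR-or-RL R X = inj₁ tt
near-or-LR-or-RL R R = inj₁ tt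

R≤Σ⇒≡R : ∀ {a} → R ≤Σ a → a ≡ R
R≤Σ⇒≡R (inj₂ refl) = refl
R≤Σ⇒≡R (inj₁ ())

≤Σ-near⇒∸≢R : ∀ {a b c} → a ≤Σ b → Near b c → a ∸ c ≢ R
≤Σ-near⇒∸≢R p n e with ∸≡R⇒ e
... | refl , refl with R≤Σ⇒≡R p
... | refl = n

Close : Word → Word → Set
Close = Pointwise Near

Close-sym : ∀ {u v} → Close u v → Close v u
Close-sym = symmetric Near-sym

length-snoc : ∀ {A : Set} (u : List A) a → length (u ++ [ a ]) ≡ suc (length u)
length-snoc [] a = refl
length-snoc (b ∷ u) a = cong suc (length-snoc u a)

take-length-++ : ∀ {A : Set} (u x : List A) → take (length u) (u ++ x) ≡ u
take-length-++ [] x = refl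
take-length-++ (a ∷ u) x = cong (a ∷_) (take-length-++ u x)

Pointwise-snoc⁻ : ∀ {A B : Set} {P : A → B → Set} {u v a b} → length u ≡ length v →
  Pointwise P (u ++ [ a ]) (v ++ [ b ]) → Pointwise P u v × P a b
Pointwise-snoc⁻ {u = []} {[]} _ (p ∷ []) = [] , p
Pointwise-snoc⁻ {u = _ ∷ u} {_ ∷ v} eq (p ∷ ps) with Pointwise-snoc⁻ {u = u} {v} (cong pred eq) ps
... | qs , q = p ∷ qs , q

Pointwise-snoc : ∀ {A B : Set} {P : A → B → Set} {u v a b} →
  Pointwise P u v → P a b → Pointwise P (u ++ [ a ]) (v ++ [ b ])
Pointwise-snoc ps p = ++⁺ ps (p ∷ [])

≤lex-refl : ∀ u → u ≤lex u
≤lex-refl [] = []≤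
≤lex-refl (a ∷ u) = ≡∷ (≤lex-refl u)

≤lex-trans : ∀ {u v w} → u ≤lex v → v ≤lex w → u ≤lex w
≤lex-trans []≤ q = []≤
≤lex-trans (<∷ p) (<∷ q) = <∷ (<Σ-trans p q)
≤lex-trans (<∷ p) (≡∷ q) = <∷ p
≤lex-trans (≡∷ p) (<∷ q) = <∷ q
≤lex-trans (≡∷ p) (≡∷ q) = ≡∷ (≤lex-trans p q)

≤lex-antisym : ∀ {u v} → u ≤lex v → v ≤lex u → u ≡ v
≤lex-antisym []≤ []≤ = refl
≤lex-antisym (<∷ p) (<∷ q) = ⊥-elim (<Σ-asym p q)
≤lex-antisym (<∷ p) (≡∷ q) = ⊥-elim (<Σ-irrefl p)
≤lex-antisym (≡∷ p) (<∷ q) = ⊥-elim (<Σ-irrefl q)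
≤lex-antisym (≡∷ p) (≡∷ q) = cong (_ ∷_) (≤lex-antisym p q)

≤lex-total : ∀ u v → u ≤lex v ⊎ v ≤lex u
≤lex-total [] v = inj₁ []≤
≤lex-total (a ∷ u) [] = inj₂ []≤
≤lex-total (a ∷ u) (b ∷ v) with <Σ-trichotomy a b
... | inj₁ p = inj₁ (<∷ p)
... | inj₂ (inj₂ p) = inj₂ (<∷ p)
... | inj₂ (inj₁ refl) with ≤lex-total u v
...   | inj₁ q = inj₁ (≡∷ q)
...   | inj₂ q = inj₂ (≡∷ q)

<lex-trans : ∀ {u v w} → u <lex v → v <lex w → u <lex w
<lex-trans (p , u≢v) (q , v≢w) = ≤lex-trans p q , λ { refl → u≢v (≤lex-antisym p q) }

++-mono-≤lex : ∀ {u v} x y → length u ≡ length v → u ≤lex v → (u ≡ v → x ≤lex y) → (u ++ x) ≤lex (v ++ y)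
++-mono-≤lex {[]} {[]} x y _ _ x≤y = x≤y refl
++-mono-≤lex {a ∷ u} {b ∷ v} x y _ (<∷ p) _ = <∷ p
++-mono-≤lex {a ∷ u} {a ∷ v} x y eq (≡∷ p) x≤y = ≡∷ (++-mono-≤lex x y (cong pred eq) p (λ e → x≤y (cong (a ∷_) e)))

++-cancel-≤lex : ∀ {u v} x y → length u ≡ length v → (u ++ x) ≤lex (v ++ y) → u ≤lex v
++-cancel-≤lex {[]} x y _ _ = []≤
++-cancel-≤lex {a ∷ u} {b ∷ v} x y _ (<∷ p) = <∷ p
++-cancel-≤lex {a ∷ u} {a ∷ v} x y eq (≡∷ p) = ≡∷ (++-cancel-≤lex x y (cong pred eq) p)

⊴∧≥lex⇒≡ : ∀ {u v} → u ⊴ v → v ≤lex u → u ≡ v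
⊴∧≥lex⇒≡ [] _ = refl
⊴∧≥lex⇒≡ (p ∷ ps) (<∷ q) = ⊥-elim (<Σ⇒≱Σ q p)
⊴∧≥lex⇒≡ (p ∷ ps) (≡∷ q) = cong (_ ∷_) (⊴∧≥lex⇒≡ ps q)

≺-++ : ∀ {u v} x y → u ≺ v → (u ++ x) ≺ (v ++ y)
≺-++ x y here = here
≺-++ x y (there p q) = there p (≺-++ x y q)

⊴⇒++L≺++R : ∀ {u v} x y → u ⊴ v → (u ++ L ∷ x) ≺ (v ++ R ∷ y)
⊴⇒++L≺++R x y [] = here
⊴⇒++L≺++R x y (p ∷ ps) = there p (⊴⇒++L≺++R x y ps)

≺-snoc⁻ : ∀ {u v a b} → length u ≡ length v → (u ++ [ a ]) ≺ (v ++ [ b ]) →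
  u ≺ v ⊎ (u ⊴ v × a ≡ L × b ≡ R)
≺-snoc⁻ {[]} {[]} _ here = inj₂ ([] , refl , refl)
≺-snoc⁻ {_ ∷ u} {_ ∷ v} _ here = inj₁ here
≺-snoc⁻ {_ ∷ u} {_ ∷ v} eq (there p q) with ≺-snoc⁻ {u} {v} (cong pred eq) q
... | inj₁ r = inj₁ (there p r)
... | inj₂ (ps , a≡L , b≡R) = inj₂ (p ∷ ps , a≡L , b≡R)

⊴∧¬Close⇒≺ : ∀ {u v} → u ⊴ v → ¬ Close u v → u ≺ v
⊴∧¬Close⇒≺ [] ¬close = ⊥-elim (¬close [])
⊴∧¬Close⇒≺ {a ∷ u} {b ∷ v} (p ∷ ps) ¬close with near-or-LR-or-RL a b
... | inj₁ n = there p (⊴∧¬Close⇒≺ ps (λ c → ¬close (n ∷ c)))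
... | inj₂ (inj₁ refl) = here
... | inj₂ (inj₂ refl) = ⊥-elim (R≰ΣL p)

-- For words of equal length, compatibility says: close, or comparable under ⊴.
CloseOrComparable : Word → Word → Set
CloseOrComparable u v = Close u v ⊎ u ⊴ v ⊎ v ⊴ u

Pointwise⇒¬Any-zip : ∀ {A B : Set} {P : A → B → Set} {Q : A × B → Set} {u v} →
  (∀ {a b} → P a b → ¬ Q (a , b)) → Pointwise P u v → ¬ Any Q (zip u v)
Pointwise⇒¬Any-zip P⇒¬Q (p ∷ ps) (here q) = P⇒¬Q p q
Pointwise⇒¬Any-zip P⇒¬Q (p ∷ ps) (there q) = Pointwise⇒¬Any-zip P⇒¬Q ps q

Pointwise⇒All-zip : ∀ {A B : Set} {P : A → B → Set} {u v} →
  Pointwise P u v → All (λ p → P (proj₁ p) (proj₂ p)) (zip u v)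
Pointwise⇒All-zip [] = []
Pointwise⇒All-zip (p ∷ ps) = p ∷ Pointwise⇒All-zip ps

All-zip⇒Pointwise : ∀ {A B : Set} {P : A → B → Set} {u v} → length u ≡ length v →
  All (λ p → P (proj₁ p) (proj₂ p)) (zip u v) → Pointwise P u v
All-zip⇒Pointwise {u = []} {[]} _ _ = []
All-zip⇒Pointwise {u = _ ∷ _} {_ ∷ _} eq (p ∷ ps) = p ∷ All-zip⇒Pointwise (cong pred eq) ps

¬Any-LR-RL⇒Close : ∀ {u v} → length u ≡ length v →
  ¬ Any (_≡ (L , R)) (zip u v) → ¬ Any (_≡ (R , L)) (zip u v) → Close u v
¬Any-LR-RL⇒Close {[]} {[]} _ _ _ = []
¬Any-LR-RL⇒Close {a ∷ u} {b ∷ v} eq ¬LR ¬RL with near-or-LR-or-RL a b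
... | inj₁ n = n ∷ ¬Any-LR-RL⇒Close (cong pred eq) (λ z → ¬LR (there z)) (λ z → ¬RL (there z))
... | inj₂ (inj₁ e) = ⊥-elim (¬LR (here e))
... | inj₂ (inj₂ e) = ⊥-elim (¬RL (here e))

≡LR? : (p : Letter × Letter) → Dec (p ≡ (L , R))
≡LR? (L , L) = no λ ()
≡LR? (L , X) = no λ ()
≡LR? (L , R) = yes refl
≡LR? (X , _) = no λ ()
≡LR? (R , _) = no λ ()

Close⇒CompatOrd : ∀ {u v} → Close u v → CompatOrd u v
Close⇒CompatOrd c = Pointwise⇒¬Any-zip (λ { () refl }) c ,
                    λ lr → ⊥-elim (Pointwise⇒¬Any-zip (λ { () refl }) c lr)

⊴⇒CompatOrd : ∀ {u v} → u ⊴ v → CompatOrd u v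
⊴⇒CompatOrd p = Pointwise⇒¬Any-zip (λ { q refl → R≰ΣL q }) p , λ _ → Pointwise⇒All-zip p

CompatOrd⇒CloseOrComparable : ∀ {u v} → length u ≡ length v → CompatOrd u v → Close u v ⊎ u ⊴ v
CompatOrd⇒CloseOrComparable {u} {v} eq (¬RL , LR⇒⊴) with any? ≡LR? (zip u v)
... | yes lr = inj₂ (All-zip⇒Pointwise {P = _≤Σ_} eq (LR⇒⊴ lr))
... | no ¬LR = inj₁ (¬Any-LR-RL⇒Close eq ¬LR ¬RL)

Compatible⇒CloseOrComparable : ∀ {u v} → length u ≡ length v → Compatible u v → CloseOrComparable u v
Compatible⇒CloseOrComparable {u} {v} eq (uv⇒ , vu⇒) with ≤lex-total u v
... | inj₁ uv with CompatOrd⇒CloseOrComparable eq (uv⇒ uv)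
...   | inj₁ c = inj₁ c
...   | inj₂ p = inj₂ (inj₁ p)
Compatible⇒CloseOrComparable {u} {v} eq (uv⇒ , vu⇒) | inj₂ vu with CompatOrd⇒CloseOrComparable (sym eq) (vu⇒ vu)
...   | inj₁ c = inj₁ (Close-sym c)
...   | inj₂ p = inj₂ (inj₂ p)

⊴⇒Compatible : ∀ {u v} → u ⊴ v → Compatible u v
⊴⇒Compatible p = (λ _ → ⊴⇒CompatOrd p) , ≥lex⇒CompatOrd p
  where
  ≥lex⇒CompatOrd : ∀ {u v} → u ⊴ v → v ≤lex u → CompatOrd v u
  ≥lex⇒CompatOrd p vu with ⊴∧≥lex⇒≡ p vu
  ... | refl = ⊴⇒CompatOrd p

CloseOrComparable⇒Compatible : ∀ {u v} → CloseOrComparable u v → Compatible u v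
CloseOrComparable⇒Compatible (inj₁ c) = (λ _ → Close⇒CompatOrd c) , (λ _ → Close⇒CompatOrd (Close-sym c))
CloseOrComparable⇒Compatible (inj₂ (inj₁ p)) = ⊴⇒Compatible p
CloseOrComparable⇒Compatible (inj₂ (inj₂ p)) = swap (⊴⇒Compatible p)

-- The McShane extension

excess : Word → Word → Letter
excess (a ∷ u) (b ∷ w) = (a ∸ b) ⊔ excess u w
excess _ _ = L

excess-self : ∀ u → excess u u ≡ L
excess-self [] = refl
excess-self (a ∷ u) rewrite a∸a≡L a = excess-self u

excess-antitone : ∀ u {w w'} → w ⊴ w' → excess u w' ≤Σ excess u w
excess-antitone [] _ = ≤Σ-refl
excess-antitone (a ∷ u) [] = ≤Σ-refl
excess-antitone (a ∷ u) (p ∷ ps) = ⊔-mono (∸-antitoneʳ a p) (excess-antitone u ps)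

excess≡L⇒⊴ : ∀ {u w} → length u ≡ length w → excess u w ≡ L → u ⊴ w
excess≡L⇒⊴ {[]} {[]} _ _ = []
excess≡L⇒⊴ {a ∷ u} {b ∷ w} eq e with ⊔≡L⇒ {a ∸ b} e
... | p , q = ∸≡L⇒≤Σ p ∷ excess≡L⇒⊴ (cong pred eq) q

⊴⇒excess≡L : ∀ {u w} → u ⊴ w → excess u w ≡ L
⊴⇒excess≡L [] = refl
⊴⇒excess≡L (p ∷ ps) rewrite ≤Σ⇒∸≡L p = ⊴⇒excess≡L ps

≺⇒excess≡R : ∀ {w u} → w ≺ u → excess u w ≡ R
≺⇒excess≡R here = refl
≺⇒excess≡R {b ∷ w} {a ∷ u} (there _ q) rewrite ≺⇒excess≡R q = ⊔-zeroʳ (a ∸ b)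

≼⇒excess≢X : ∀ {w u} → w ≼ u → excess u w ≢ X
≼⇒excess≢X (inj₁ w≺u) eq with trans (sym (≺⇒excess≡R w≺u)) eq
... | ()
≼⇒excess≢X {u = u} (inj₂ refl) eq with trans (sym (excess-self u)) eq
... | ()

excess≡L-Close⇒≢R : ∀ u {w w'} → excess u w ≡ L → Close w w' → excess u w' ≢ R
excess≡L-Close⇒≢R (a ∷ u) {b ∷ w} {c ∷ w'} e (n ∷ ns) e' with ⊔≡L⇒ {a ∸ b} e | ⊔≡R⇒ {a ∸ c} e'
... | p , q | inj₁ r = ≤Σ-near⇒∸≢R (∸≡L⇒≤Σ p) n r
... | p , q | inj₂ r = excess≡L-Close⇒≢R u q ns r

Monotone : (Word → Letter) → Set
Monotone F = ∀ {w w'} → w ⊴ w' → F w ≤Σ F w'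

Lipschitz : (Word → Letter) → Set
Lipschitz F = ∀ {w w'} → Close w w' → F w ≡ R → F w' ≢ L

extension : List (Word × Letter) → Word → Letter
extension [] w = L
extension ((u , a) ∷ P) w = (a ∸ excess u w) ⊔ extension P w

extension-≥ : ∀ {P u a} w → (u , a) ∈ P → (a ∸ excess u w) ≤Σ extension P w
extension-≥ {_ ∷ P} w (here refl) = a≤a⊔b _ _
extension-≥ {_ ∷ P} w (there m) = ≤Σ-trans (extension-≥ w m) (b≤a⊔b _ _)

extension-lub : ∀ P w {c} → (∀ {u a} → (u , a) ∈ P → (a ∸ excess u w) ≤Σ c) → extension P w ≤Σ c
extension-lub [] w h = L≤Σ
extension-lub ((u , a) ∷ P) w h = ⊔-lub (h (here refl)) (extension-lub P w (λ m → h (there m)))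

extension-monotone : ∀ P → Monotone (extension P)
extension-monotone [] _ = ≤Σ-refl
extension-monotone ((u , a) ∷ P) p = ⊔-mono (∸-antitoneʳ a (excess-antitone u p)) (extension-monotone P p)

extension≡R⇒ : ∀ P w → extension P w ≡ R → ∃[ u ] ((u , R) ∈ P × excess u w ≡ L)
extension≡R⇒ ((u , a) ∷ P) w e with ⊔≡R⇒ {a ∸ excess u w} e
... | inj₁ r with ∸≡R⇒ {a} r
...   | refl , q = u , here refl , q
extension≡R⇒ ((u , a) ∷ P) w e | inj₂ r with extension≡R⇒ P w r
... | v , m , q = v , there m , q

extension-lipschitz : ∀ P → Lipschitz (extension P)
extension-lipschitz P {w} {w'} close e e' with extension≡R⇒ P w e
... | u , m , q = excess≡L-Close⇒≢R u q close (R∸≡L⇒ (≤ΣL⇒≡L R∸excess≤L))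
  where
  R∸excess≤L : (R ∸ excess u w') ≤Σ L
  R∸excess≤L = subst ((R ∸ excess u w') ≤Σ_) e' (extension-≥ w' m)

Consistent : List (Word × Letter) → Set
Consistent P = All (λ { (u , a) → All (λ { (v , b) → (a ∸ excess u v) ≤Σ b }) P }) P

consistent? : ∀ P → Dec (Consistent P)
consistent? P = all? (λ _ → all? (λ _ → _ ≤Σ? _) P) P

extension-extends : ∀ {P u a} → Consistent P → (u , a) ∈ P → extension P u ≡ a
extension-extends {P} {u} {a} c m = ≤Σ-antisym
  (extension-lub P u (λ m' → All-lookup (All-lookup c m') m))
  (subst (_≤Σ extension P u) a∸excess≡a (extension-≥ u m))
  where
  a∸excess≡a : a ∸ excess u u ≡ a
  a∸excess≡a = trans (cong (a ∸_) (excess-self u)) (∸-identityʳ a)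

graph : (S : List Word) → Vec Letter (length S) → List (Word × Letter)
graph [] []ᵥ = []
graph (u ∷ S) (a ∷ᵥ e) = (u , a) ∷ graph S e

∈-graph⇒∈ : ∀ {S e u a} → (u , a) ∈ graph S e → u ∈ S
∈-graph⇒∈ {[]} {[]ᵥ} ()
∈-graph⇒∈ {_ ∷ S} {_ ∷ᵥ e} (here refl) = here refl
∈-graph⇒∈ {_ ∷ S} {_ ∷ᵥ e} (there m) = there (∈-graph⇒∈ m)

∈⇒∈-graph : ∀ {S e u} → u ∈ S → ∃[ a ] ((u , a) ∈ graph S e)
∈⇒∈-graph {_ ∷ S} {a ∷ᵥ e} (here refl) = a , here refl
∈⇒∈-graph {_ ∷ S} {_ ∷ᵥ e} (there m) with ∈⇒∈-graph {S} {e} m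
... | b , m' = b , there m'

∈-graph⇒∈-ext : ∀ {S e u a} → (u , a) ∈ graph S e → (u ++ [ a ]) ∈ ext S e
∈-graph⇒∈-ext {[]} {[]ᵥ} ()
∈-graph⇒∈-ext {_ ∷ S} {_ ∷ᵥ e} (here refl) = here refl
∈-graph⇒∈-ext {_ ∷ S} {_ ∷ᵥ e} (there m) = there (∈-graph⇒∈-ext m)

∈-ext⇒∈-graph : ∀ {S e x} → x ∈ ext S e → ∃[ u ] ∃[ a ] ((u , a) ∈ graph S e × x ≡ u ++ [ a ])
∈-ext⇒∈-graph {u ∷ S} {a ∷ᵥ e} (here refl) = u , a , here refl , refl
∈-ext⇒∈-graph {_ ∷ S} {_ ∷ᵥ e} (there m) with ∈-ext⇒∈-graph {S} {e} m
... | v , b , m' , eq = v , b , there m' , eq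

∈-graph-map : ∀ {S u a} (F : Word → Letter) → (u , a) ∈ graph S (mapᵥ F (fromList S)) → a ≡ F u
∈-graph-map {_ ∷ S} F (here refl) = refl
∈-graph-map {_ ∷ S} F (there m) = ∈-graph-map F m

ext-sorted : ∀ {ℓ} S e → All (λ w → length w ≡ ℓ) S → Linked _<lex_ S → Linked _<lex_ (ext S e)
ext-sorted [] []ᵥ _ _ = []
ext-sorted (u ∷ []) (a ∷ᵥ []ᵥ) _ _ = [-]
ext-sorted (u ∷ v ∷ S) (a ∷ᵥ b ∷ᵥ e) (lu ∷ lv ∷ ls) ((u≤v , u≢v) ∷ l) =
  (++-mono-≤lex _ _ (trans lu (sym lv)) u≤v (λ u≡v → ⊥-elim (u≢v u≡v)) , λ eq → u≢v (∷ʳ-injectiveˡ u v eq))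
  ∷ ext-sorted (v ∷ S) (b ∷ᵥ e) (lv ∷ ls) l

take-snoc : ∀ {ℓ} {u : Word} a → length u ≡ ℓ → take ℓ (u ++ [ a ]) ≡ u
take-snoc {u = u} a refl = take-length-++ u [ a ]

module Levels {ℓ : ℕ} {S : List Word} (lengths : All (λ w → length w ≡ ℓ) S) (e : Vec Letter (length S)) where

  private
    T : List Word
    T = ext S e

  length-∈-graph : ∀ {u a} → (u , a) ∈ graph S e → length (u ++ [ a ]) ≡ suc ℓ
  length-∈-graph {u} {a} m = trans (length-snoc u a) (cong suc (All-lookup lengths (∈-graph⇒∈ m)))

  length-∈-ext : ∀ {x} → x ∈ T → length x ≡ suc ℓ
  length-∈-ext m with ∈-ext⇒∈-graph m
  ... | _ , _ , mg , refl = length-∈-graph mg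

  Bar-ℓ⇒∈ : ∀ {w} → Bar T ℓ w → w ∈ S
  Bar-ℓ⇒∈ (x , m , _ , refl) with ∈-ext⇒∈-graph m
  ... | u , a , mg , refl = subst (_∈ S) (sym (take-snoc a (All-lookup lengths (∈-graph⇒∈ mg)))) (∈-graph⇒∈ mg)

  ∈⇒Bar-ℓ : ∀ {w} → w ∈ S → Bar T ℓ w
  ∈⇒Bar-ℓ {w} m with ∈⇒∈-graph {S} {e} m
  ... | a , mg = w ++ [ a ] , ∈-graph⇒∈-ext mg , subst (ℓ ≤_) (sym (length-∈-graph mg)) (n≤1+n ℓ) ,
                 sym (take-snoc a (All-lookup lengths m))

  Bar-suc⇒∈ : ∀ {x} → Bar T (suc ℓ) x → x ∈ T
  Bar-suc⇒∈ (x , m , _ , refl) = subst (_∈ T) (sym (take-all (suc ℓ) x (≤-reflexive (length-∈-ext m)))) m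

  ∈⇒Bar-suc : ∀ {x} → x ∈ T → Bar T (suc ℓ) x
  ∈⇒Bar-suc {x} m = x , m , ≤-reflexive (sym (length-∈-ext m)) , sym (take-all (suc ℓ) x (≤-reflexive (length-∈-ext m)))

map≡ext⇒ : ∀ {S e} (f : Word → Word) → map f S ≡ ext S e → ∀ {u a} → (u , a) ∈ graph S e → f u ≡ u ++ [ a ]
map≡ext⇒ {[]} {[]ᵥ} f eq ()
map≡ext⇒ {_ ∷ S} {_ ∷ᵥ e} f eq (here refl) = proj₁ (∷-injective eq)
map≡ext⇒ {_ ∷ S} {_ ∷ᵥ e} f eq (there m) = map≡ext⇒ {S} {e} f (proj₂ (∷-injective eq)) m

-- Boring extensions of all of Σ*_ℓ

module Extend (F : Word → Letter) (mono : Monotone F) (lip : Lipschitz F) where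

  extend : Word → Word
  extend u = u ++ [ F u ]

  extend-≤lex⇔ : ∀ {u v} → length u ≡ length v → (u ≤lex v) ⇔ (extend u ≤lex extend v)
  extend-≤lex⇔ {u} {v} eq = mk⇔
    (λ u≤v → ++-mono-≤lex _ _ eq u≤v (λ { refl → ≤lex-refl _ }))
    (++-cancel-≤lex _ _ eq)

  extend-⊴⇔ : ∀ {u v} → length u ≡ length v → (u ⊴ v) ⇔ (extend u ⊴ extend v)
  extend-⊴⇔ eq = mk⇔ (λ p → Pointwise-snoc p (mono p)) (λ p → proj₁ (Pointwise-snoc⁻ eq p))

  extend-≼⇔ : ∀ {u v} → length u ≡ length v → (u ≼ v) ⇔ (extend u ≼ extend v)
  extend-≼⇔ {u} {v} eq = mk⇔ to from
    where
    to : u ≼ v → extend u ≼ extend v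
    to (inj₁ p) = inj₁ (≺-++ _ _ p)
    to (inj₂ refl) = inj₂ refl
    from : extend u ≼ extend v → u ≼ v
    from (inj₂ e) = inj₂ (∷ʳ-injectiveˡ u v e)
    from (inj₁ p) with ≺-snoc⁻ {u} {v} eq p
    ... | inj₁ q = inj₁ q
    ... | inj₂ (u⊴v , Fu≡L , Fv≡R) = inj₁ (⊴∧¬Close⇒≺ u⊴v (λ c → lip (Close-sym c) Fv≡R Fu≡L))

  extend-CloseOrComparable : ∀ {u v} → CloseOrComparable u v → CloseOrComparable (extend u) (extend v)
  extend-CloseOrComparable {u} {v} (inj₁ c) with near-or-LR-or-RL (F u) (F v)
  ... | inj₁ n = inj₁ (Pointwise-snoc c n)
  ... | inj₂ (inj₁ e) = ⊥-elim (lip (Close-sym c) (cong proj₂ e) (cong proj₁ e))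
  ... | inj₂ (inj₂ e) = ⊥-elim (lip c (cong proj₁ e) (cong proj₂ e))
  extend-CloseOrComparable (inj₂ (inj₁ p)) = inj₂ (inj₁ (Pointwise-snoc p (mono p)))
  extend-CloseOrComparable (inj₂ (inj₂ p)) = inj₂ (inj₂ (Pointwise-snoc p (mono p)))

  module _ {ℓ : ℕ} {S : List Word} (lengths : All (λ w → length w ≡ ℓ) S) where

    private
      T : List Word
      T = ext S (mapᵥ F (fromList S))

    open Levels lengths (mapᵥ F (fromList S))

    ∈-ext⇒extend : ∀ {x} → x ∈ T → ∃[ u ] (u ∈ S × x ≡ extend u)
    ∈-ext⇒extend m with ∈-ext⇒∈-graph m
    ... | u , a , mg , refl = u , ∈-graph⇒∈ mg , cong (λ b → u ++ [ b ]) (∈-graph-map F mg)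

    ∈⇒extend∈ : ∀ {u} → u ∈ S → extend u ∈ T
    ∈⇒extend∈ {u} m with ∈⇒∈-graph {S} {mapᵥ F (fromList S)} m
    ... | a , mg = subst (λ b → (u ++ [ b ]) ∈ T) (∈-graph-map F mg) (∈-graph⇒∈-ext mg)

    take-extend : ∀ {u} → u ∈ S → take ℓ (extend u) ≡ u
    take-extend {u} m = take-snoc (F u) (All-lookup lengths m)

    levelIso : LevelIso (Bar T ℓ) (Bar T (suc ℓ))
    levelIso = extend , take ℓ
      , (λ _ b → ∈⇒Bar-suc (∈⇒extend∈ (Bar-ℓ⇒∈ b)))
      , (λ _ b → take-Bar (Bar-suc⇒∈ b))
      , (λ _ b → take-extend (Bar-ℓ⇒∈ b))
      , (λ _ b → extend-take (Bar-suc⇒∈ b))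
      , λ _ _ bu bv → let eq = same-length bu bv in extend-≤lex⇔ eq , extend-≼⇔ eq , extend-⊴⇔ eq
      where
      take-Bar : ∀ {x} → x ∈ T → Bar T ℓ (take ℓ x)
      take-Bar m with ∈-ext⇒extend m
      ... | u , mu , refl = subst (Bar T ℓ) (sym (take-extend mu)) (∈⇒Bar-ℓ mu)
      extend-take : ∀ {x} → x ∈ T → extend (take ℓ x) ≡ x
      extend-take m with ∈-ext⇒extend m
      ... | u , mu , refl = cong extend (take-extend mu)
      same-length : ∀ {u v} → Bar T ℓ u → Bar T ℓ v → length u ≡ length v
      same-length bu bv = trans (All-lookup lengths (Bar-ℓ⇒∈ bu)) (sym (All-lookup lengths (Bar-ℓ⇒∈ bv)))

    monotone-lipschitz⇒boring : Boring ℓ S (mapᵥ F (fromList S))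
    monotone-lipschitz⇒boring (inj₁ ¬iso) = ¬iso levelIso
    monotone-lipschitz⇒boring (inj₂ (inj₁ (x , y , bx , by , ¬compat , compat)))
      with ∈-ext⇒extend (Bar-suc⇒∈ bx) | ∈-ext⇒extend (Bar-suc⇒∈ by)
    ... | u , mu , refl | v , mv , refl = ¬compat (CloseOrComparable⇒Compatible
          (extend-CloseOrComparable (Compatible⇒CloseOrComparable same-length
            (subst₂ Compatible (take-extend mu) (take-extend mv) compat))))
      where
      same-length : length u ≡ length v
      same-length = trans (All-lookup lengths mu) (sym (All-lookup lengths mv))
    monotone-lipschitz⇒boring (inj₂ (inj₂ (x , m , length≡ℓ))) = 1+n≢n (trans (sym (length-∈-ext m)) length≡ℓ)

head-<lex-tail : ∀ {a xs} → Linked _<lex_ (a ∷ xs) → All (a <lex_) xs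
head-<lex-tail [-] = []
head-<lex-tail (a<b ∷ l) = Linked⇒All <lex-trans a<b l

head-≤lex : ∀ {a xs x} → Linked _<lex_ (a ∷ xs) → x ∈ a ∷ xs → a ≤lex x
head-≤lex _ (here refl) = ≤lex-refl _
head-≤lex l (there m) = proj₁ (All-lookup (head-<lex-tail l) m)

head-≢-tail : ∀ {a xs x} → Linked _<lex_ (a ∷ xs) → x ∈ xs → a ≢ x
head-≢-tail l m = proj₂ (All-lookup (head-<lex-tail l) m)

monotone-bijection⇒map≡ : ∀ (A B : List Word) → Linked _<lex_ A → Linked _<lex_ B → (f g : Word → Word)
  → (∀ {u} → u ∈ A → f u ∈ B) → (∀ {v} → v ∈ B → g v ∈ A)
  → (∀ {u} → u ∈ A → g (f u) ≡ u) → (∀ {v} → v ∈ B → f (g v) ≡ v)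
  → (∀ {u v} → u ∈ A → v ∈ A → u ≤lex v → f u ≤lex f v) → map f A ≡ B
monotone-bijection⇒map≡ [] [] _ _ f g f∈ g∈ gf fg mono = refl
monotone-bijection⇒map≡ [] (b ∷ B) _ _ f g f∈ g∈ gf fg mono with g∈ (here refl)
... | ()
monotone-bijection⇒map≡ (a ∷ A) [] _ _ f g f∈ g∈ gf fg mono with f∈ (here refl)
... | ()
monotone-bijection⇒map≡ (a ∷ A) (b ∷ B) sA sB f g f∈ g∈ gf fg mono = cong₂ _∷_ fa≡b
  (monotone-bijection⇒map≡ A B (Linked-tail sA) (Linked-tail sB) f g f∈′ g∈′
    (λ m → gf (there m)) (λ m → fg (there m)) (λ m m′ → mono (there m) (there m′)))
  where
  fa≡b : f a ≡ b
  fa≡b = ≤lex-antisym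
    (subst (f a ≤lex_) (fg (here refl)) (mono (here refl) (g∈ (here refl)) (head-≤lex sA (g∈ (here refl)))))
    (head-≤lex sB (f∈ (here refl)))
  f∈′ : ∀ {u} → u ∈ A → f u ∈ B
  f∈′ m with f∈ (there m)
  ... | there m′ = m′
  ... | here fu≡b = ⊥-elim (head-≢-tail sA m
          (trans (sym (gf (here refl))) (trans (cong g (trans fa≡b (sym fu≡b))) (gf (there m)))))
  g∈′ : ∀ {v} → v ∈ B → g v ∈ A
  g∈′ m with g∈ (there m)
  ... | there m′ = m′
  ... | here gv≡a = ⊥-elim (head-≢-tail sB m
          (trans (sym fa≡b) (trans (cong f (sym gv≡a)) (fg (there m)))))

-- Consistency of a boring extension

module FromBoring {ℓ : ℕ} {S : List Word} (lengths : All (λ w → length w ≡ ℓ) S) (sorted : Linked _<lex_ S)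
  (compatible : MutuallyCompatible S) (e : Vec Letter (length S)) (boring : Boring ℓ S e) where

  private
    P : List (Word × Letter)
    P = graph S e
    T : List Word
    T = ext S e

  open Levels lengths e

  same-length : ∀ {u a v b} → (u , a) ∈ P → (v , b) ∈ P → length u ≡ length v
  same-length mu mv = trans (All-lookup lengths (∈-graph⇒∈ mu)) (sym (All-lookup lengths (∈-graph⇒∈ mv)))

  -- Otherwise u R and v L form an incompatible pair over the compatible prefixes u, v.
  RL⇒¬¬⊴ : ∀ {u v} → (u , R) ∈ P → (v , L) ∈ P → ¬ ¬ (v ⊴ u)
  RL⇒¬¬⊴ {u} {v} mu mv ¬v⊴u = boring (inj₂ (inj₁
    (u ++ [ R ] , v ++ [ L ] , ∈⇒Bar-suc (∈-graph⇒∈-ext mu) , ∈⇒Bar-suc (∈-graph⇒∈-ext mv) ,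
     incompatible , subst₂ Compatible (sym (take-snoc R lu)) (sym (take-snoc L lv)) (compatible (∈-graph⇒∈ mu) (∈-graph⇒∈ mv)))))
    where
    lu = All-lookup lengths (∈-graph⇒∈ mu)
    lv = All-lookup lengths (∈-graph⇒∈ mv)
    incompatible : ¬ Compatible (u ++ [ R ]) (v ++ [ L ])
    incompatible c with Compatible⇒CloseOrComparable (trans (length-snoc u R) (trans (cong suc (same-length mu mv)) (sym (length-snoc v L)))) c
    ... | inj₁ close = proj₂ (Pointwise-snoc⁻ (same-length mu mv) close)
    ... | inj₂ (inj₁ p) = R≰ΣL (proj₂ (Pointwise-snoc⁻ (same-length mu mv) p))
    ... | inj₂ (inj₂ p) = ¬v⊴u (proj₁ (Pointwise-snoc⁻ (same-length mv mu) p))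

  private
    Isomorphic : Set
    Isomorphic = LevelIso (Bar T ℓ) (Bar T (suc ℓ))

  iso-extends : (iso : Isomorphic) → ∀ {u a} → (u , a) ∈ P → proj₁ iso u ≡ u ++ [ a ]
  iso-extends (f , g , f∈ , g∈ , gf , fg , preserves) = map≡ext⇒ f
    (monotone-bijection⇒map≡ S T sorted (ext-sorted S e lengths sorted) f g
      (λ m → Bar-suc⇒∈ (f∈ _ (∈⇒Bar-ℓ m))) (λ m → Bar-ℓ⇒∈ (g∈ _ (∈⇒Bar-suc m)))
      (λ m → gf _ (∈⇒Bar-ℓ m)) (λ m → fg _ (∈⇒Bar-suc m))
      (λ mu mv → Equivalence.to (proj₁ (preserves _ _ (∈⇒Bar-ℓ mu) (∈⇒Bar-ℓ mv)))))

  iso-⊴ : Isomorphic → ∀ {u a v b} → (u , a) ∈ P → (v , b) ∈ P → u ⊴ v → a ≤Σ b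
  iso-⊴ iso@(_ , _ , _ , _ , _ , _ , preserves) mu mv u⊴v =
    proj₂ (Pointwise-snoc⁻ (same-length mu mv) (subst₂ _⊴_ (iso-extends iso mu) (iso-extends iso mv)
      (Equivalence.to (proj₂ (proj₂ (preserves _ _ (∈⇒Bar-ℓ (∈-graph⇒∈ mu)) (∈⇒Bar-ℓ (∈-graph⇒∈ mv))))) u⊴v)))

  iso-≼ : Isomorphic → ∀ {u a v b} → (u , a) ∈ P → (v , b) ∈ P → (u ++ [ a ]) ≼ (v ++ [ b ]) → u ≼ v
  iso-≼ iso@(_ , _ , _ , _ , _ , _ , preserves) mu mv p =
    Equivalence.from (proj₁ (proj₂ (preserves _ _ (∈⇒Bar-ℓ (∈-graph⇒∈ mu)) (∈⇒Bar-ℓ (∈-graph⇒∈ mv)))))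
      (subst₂ _≼_ (sym (iso-extends iso mu)) (sym (iso-extends iso mv)) p)

  RL⇒excess≢X : Isomorphic → ∀ {u v} → (u , R) ∈ P → (v , L) ∈ P → excess u v ≢ X
  RL⇒excess≢X iso mu mv excess≡X =
    RL⇒¬¬⊴ mu mv (λ v⊴u → ≼⇒excess≢X (iso-≼ iso mv mu (inj₁ (⊴⇒++L≺++R [] [] v⊴u))) excess≡X)

  iso⇒consistent : Isomorphic → Consistent P
  iso⇒consistent iso = tabulate λ mu → tabulate λ mv → consistent-pair mu mv
    where
    consistent-pair : ∀ {u a v b} → (u , a) ∈ P → (v , b) ∈ P → (a ∸ excess u v) ≤Σ b
    consistent-pair {u} {a} {v} {b} mu mv with excess u v in eq
    ... | L = subst (_≤Σ b) (sym (∸-identityʳ a)) (iso-⊴ iso mu mv (excess≡L⇒⊴ (same-length mu mv) eq))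
    ... | R = subst (_≤Σ b) (sym (a∸R≡L a)) L≤Σ
    ... | X = X-case a b mu mv eq
      where
      X-case : ∀ a b → (u , a) ∈ P → (v , b) ∈ P → excess u v ≡ X → (a ∸ X) ≤Σ b
      X-case L _ _ _ _ = L≤Σ
      X-case X _ _ _ _ = L≤Σ
      X-case R X _ _ _ = ≤Σ-refl
      X-case R R _ _ _ = inj₁ X<R
      X-case R L mu mv eq = ⊥-elim (RL⇒excess≢X iso mu mv eq)

  -- Boringness only refutes the negation of a level isomorphism; consistency is decidable.
  consistent : Consistent P
  consistent with consistent? P
  ... | yes c = c
  ... | no ¬c = ⊥-elim (boring (inj₁ (λ iso → ¬c (iso⇒consistent iso))))

∈-allWords⇒length : ∀ ℓ {w} → w ∈ allWords ℓ → length w ≡ ℓ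
∈-allWords⇒length 0 (here refl) = refl
∈-allWords⇒length (suc ℓ) m with satisfied (∈-concatMap⁻ (λ a → map (a ∷_) (allWords ℓ)) {xs = L ∷ X ∷ R ∷ []} m)
... | a , m′ with ∈-map⁻ (a ∷_) m′
...   | v , mv , refl = cong suc (∈-allWords⇒length ℓ mv)

∈-allWords : ∀ w → w ∈ allWords (length w)
∈-allWords [] = here refl
∈-allWords (a ∷ w) = ∈-concatMap⁺ (λ b → map (b ∷_) (allWords (length w))) (row a (∈-map⁺ (a ∷_) (∈-allWords w)))
  where
  row : ∀ {P : Letter → Set} a → P a → Any P (L ∷ X ∷ R ∷ [])
  row L p = here p
  row X p = there (here p)
  row R p = there (there (here p))

mainTheorem5 : (ℓ : ℕ) (S : List Word)
    → All (λ w → length w ≡ ℓ) S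
    → Linked _<lex_ S
    → MutuallyCompatible S
    → (e : Vec Letter (length S))
    → Boring ℓ S e
    → Σ[ e' ∈ Vec Letter (length (allWords ℓ)) ]
        (Boring ℓ (allWords ℓ) e' × (∀ w → w ∈ ext S e → w ∈ ext (allWords ℓ) e'))
mainTheorem5 ℓ S lengths sorted compatible e boring =
  mapᵥ F (fromList (allWords ℓ)) , monotone-lipschitz⇒boring allWords-lengths , ext-⊆
  where
  F : Word → Letter
  F = extension (graph S e)
  open Extend F (extension-monotone (graph S e)) (extension-lipschitz (graph S e))
  open FromBoring lengths sorted compatible e boring using (consistent)
  allWords-lengths : All (λ w → length w ≡ ℓ) (allWords ℓ)
  allWords-lengths = tabulate (∈-allWords⇒length ℓ)
  ext-⊆ : ∀ w → w ∈ ext S e → w ∈ ext (allWords ℓ) (mapᵥ F (fromList (allWords ℓ)))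
  ext-⊆ _ m with ∈-ext⇒∈-graph m
  ... | u , a , mg , refl = subst (λ b → (u ++ [ b ]) ∈ ext (allWords ℓ) (mapᵥ F (fromList (allWords ℓ))))
          (extension-extends consistent mg)
          (∈⇒extend∈ allWords-lengths (subst (λ n → u ∈ allWords n) (All-lookup lengths (∈-graph⇒∈ mg)) (∈-allWords u)))
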